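{- Let $n$ be an integer divisible by $4$, let $\mathcal{D}$ be the uniform distribution over $\{0,1\}^n$, and let $\mathcal{D}'$ be the uniform distribution over $\{x\in\{0,1\}^n : \bigoplus_{i=1}^n x_i = 1\}$. Then \[\mathbb{E}_{\mathbf{x}\sim\mathcal{D}'}[\mathrm{dist}(\mathbf{x},\{0^n,1^n\})] \le \mathbb{E}_{\mathbf{x}\sim\mathcal{D}}[\mathrm{dist}(\mathbf{x},\{0^n,1^n\})] - \frac{1}{n}.\]
   Context: $\mathrm{dist}$ is Hamming distance, and the distance from a string to a set of strings is the minimum over the set; thus $\mathrm{dist}(x,\{0^n,1^n\})=\min(\#\text{ones of }x,\#\text{zeros of }x)$. -}

module Defs where

open import Data.Bool using (Bool; true; false; _xor_)
open import Data.Nat using (ℕ; zero; suc; _⊓_)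
open import Data.Integer using (+_)
open import Data.Rational using (ℚ; 0ℚ; _/_)
open import Data.List using (List; []; _∷_; [_]; map; _++_; filter; length)
open import Data.Nat.ListAction using (sum)
open import Data.Vec using (Vec; []; _∷_; count; foldr′)
open import Data.Bool.Properties using () renaming (_≟_ to _≟ᵇ_)
open import Function using (_∘_)

BitString : ℕ → Set
BitString n = Vec Bool n

allStrings : (n : ℕ) → List (BitString n)
allStrings zero    = [ [] ]
allStrings (suc n) = map (false ∷_) (allStrings n) ++ map (true ∷_) (allStrings n)

ones : ∀ {n} → BitString n → ℕ
ones = count (λ b → b ≟ᵇ true)

zeros : ∀ {n} → BitString n → ℕ
zeros = count (λ b → b ≟ᵇ false)

distConst : ∀ {n} → BitString n → ℕ
distConst x = ones x ⊓ zeros x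

parity : ∀ {n} → BitString n → Bool
parity = foldr′ _xor_ false

oddStrings : (n : ℕ) → List (BitString n)
oddStrings n = filter (λ x → parity x ≟ᵇ true) (allStrings n)

-- Uniform expectation of f over a (duplicate-free) finite list support.
expect : ∀ {A : Set} → (A → ℕ) → List A → ℚ
expect f []       = 0ℚ
expect f (a ∷ as) = (+ sum (map f (a ∷ as))) / suc (length as)

-- For a string x with k ones, (-1)^{parity x} = (-1)^k and dist(x, {0ⁿ,1ⁿ}) = min(k, n − k), so
-- Σ_x (-1)^{parity x} dist(x) is the alternating binomial sum Σ_k (-1)^k (n C k) min(k, n − k).
-- Taking differences twice turns the tent k ↦ min(k, n − k) into −2 times the point mass at n/2 − 1
-- (plus a constant, which alternating sums annihilate), so for n = 2j + 2 the sum is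
-- (-1)^{j+1} · 2 (2j C j), that is 2 (2j C j) when 4 ∣ n. As even and odd strings are equinumerous,
-- E_D[dist] − E_D'[dist] = 2 (2j C j) / 2ⁿ, which is at least 1/n because 4^j ≤ (j + 1) (2j C j).

module Submission where

open import Defs
open import Data.Bool using (Bool; true; false; _xor_)
open import Data.Bool.Properties using () renaming (_≟_ to _≟ᵇ_)
open import Data.Nat as ℕ using (ℕ; zero; suc; NonZero)
import Data.Nat.Properties as ℕ
open import Data.Nat.Combinatorics using (_C_; nC1≡n; nCk≡nC[n∸k]; nCk+nC[k+1]≡[n+1]C[k+1])
open import Data.Nat.ListAction using (sum)
open import Data.Integer as ℤ using (ℤ; +_; 1ℤ; -1ℤ)
import Data.Integer.Properties as ℤ
open import Data.List using (List; []; _∷_; map; _++_; filter; length)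
import Data.List.Properties as List
open import Data.Vec using ([]; _∷_)
open import Function using (_∘_)
open import Relation.Binary.PropositionalEquality

-- Central binomial coefficients
module _ where
  open import Data.Nat using (_+_; _*_; _^_; _≤_)
  open import Data.Nat.Properties
  open import Data.Nat.Tactic.RingSolver using (solve-∀)
  open import Algebra.Properties.CommutativeSemigroup *-commutativeSemigroup using (x∙yz≈y∙xz)

  [k+1]*[n+1]C[k+1]≡[n+1]*nCk : ∀ n k → suc k * (suc n C suc k) ≡ suc n * (n C k)
  [k+1]*[n+1]C[k+1]≡[n+1]*nCk zero    zero    = refl
  [k+1]*[n+1]C[k+1]≡[n+1]*nCk zero    (suc k) = *-zeroʳ (suc (suc k))
  [k+1]*[n+1]C[k+1]≡[n+1]*nCk (suc n) zero    =
    trans (*-identityˡ _) (trans (nC1≡n (suc (suc n))) (sym (*-identityʳ _)))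
  [k+1]*[n+1]C[k+1]≡[n+1]*nCk (suc n) (suc k) = begin
    suc (suc k) * (suc (suc n) C suc (suc k))
      ≡⟨ cong (suc (suc k) *_) (nCk+nC[k+1]≡[n+1]C[k+1] (suc n) (suc k)) ⟨
    suc (suc k) * (X + Y)                    ≡⟨ distribute (suc k) X Y ⟩
    suc k * X + suc (suc k) * Y + X
      ≡⟨ cong₂ (λ u v → u + v + X) ([k+1]*[n+1]C[k+1]≡[n+1]*nCk n k) ([k+1]*[n+1]C[k+1]≡[n+1]*nCk n (suc k)) ⟩
    suc n * (n C k) + suc n * (n C suc k) + X
      ≡⟨ cong (_+ X) (*-distribˡ-+ (suc n) (n C k) (n C suc k)) ⟨
    suc n * (n C k + n C suc k) + X          ≡⟨ cong (λ u → suc n * u + X) (nCk+nC[k+1]≡[n+1]C[k+1] n k) ⟩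
    suc n * X + X                            ≡⟨ +-comm (suc n * X) X ⟩
    suc (suc n) * X                          ∎
    where
    open ≡-Reasoning
    X = suc n C suc k
    Y = suc n C suc (suc k)
    distribute : ∀ a x y → suc a * (x + y) ≡ a * x + suc a * y + x
    distribute = solve-∀

  centralBinomial : ℕ → ℕ
  centralBinomial j = (j + j) C j

  centralBinomial-rec : ∀ j → suc j * centralBinomial (suc j) ≡ 2 * suc (j + j) * centralBinomial j
  centralBinomial-rec j = *-cancelˡ-≡ _ _ (suc j) (begin
    suc j * (suc j * ((suc j + suc j) C suc j))
      ≡⟨ cong (λ m → suc j * (suc j * (m C suc j))) (+-suc (suc j) j) ⟩
    suc j * (suc j * (suc (suc (j + j)) C suc j))
      ≡⟨ cong (suc j *_) ([k+1]*[n+1]C[k+1]≡[n+1]*nCk (suc (j + j)) j) ⟩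
    suc j * (suc (suc (j + j)) * (suc (j + j) C j))
      ≡⟨ cong (λ m → suc j * (suc (suc (j + j)) * m)) symmetric ⟩
    suc j * (suc (suc (j + j)) * (suc (j + j) C suc j))
      ≡⟨ x∙yz≈y∙xz (suc j) (suc (suc (j + j))) (suc (j + j) C suc j) ⟩
    suc (suc (j + j)) * (suc j * (suc (j + j) C suc j))
      ≡⟨ cong (suc (suc (j + j)) *_) ([k+1]*[n+1]C[k+1]≡[n+1]*nCk (j + j) j) ⟩
    suc (suc (j + j)) * (suc (j + j) * centralBinomial j)
      ≡⟨ regroup j (centralBinomial j) ⟩
    suc j * (2 * suc (j + j) * centralBinomial j) ∎)
    where
    open ≡-Reasoning
    symmetric : suc (j + j) C j ≡ suc (j + j) C suc j
    symmetric = trans (nCk≡nC[n∸k] (m≤n+m j (suc j))) (cong (suc (j + j) C_) (m+n∸n≡m (suc j) j))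
    regroup : ∀ j c → suc (suc (j + j)) * (suc (j + j) * c) ≡ suc j * (2 * suc (j + j) * c)
    regroup = solve-∀

  4^j≤[j+1]*centralBinomial : ∀ j → 4 ^ j ≤ suc j * centralBinomial j
  4^j≤[j+1]*centralBinomial zero    = ≤-refl
  4^j≤[j+1]*centralBinomial (suc j) = *-cancelˡ-≤ (suc j) (begin
    suc j * 4 ^ suc j                          ≡⟨ x∙yz≈y∙xz (suc j) 4 (4 ^ j) ⟩
    4 * (suc j * 4 ^ j)                        ≤⟨ *-monoʳ-≤ 4 (*-monoʳ-≤ (suc j) (4^j≤[j+1]*centralBinomial j)) ⟩
    4 * (suc j * (suc j * c))                  ≡⟨ regroup j c ⟩
    (4 * suc j * suc j) * c                    ≤⟨ *-monoˡ-≤ c 4[j+1]²≤[j+2]*2[2j+1] ⟩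
    (suc (suc j) * (2 * suc (j + j))) * c      ≡⟨ *-assoc (suc (suc j)) (2 * suc (j + j)) c ⟩
    suc (suc j) * (2 * suc (j + j) * c)        ≡⟨ cong (suc (suc j) *_) (centralBinomial-rec j) ⟨
    suc (suc j) * (suc j * centralBinomial (suc j)) ≡⟨ x∙yz≈y∙xz (suc (suc j)) (suc j) (centralBinomial (suc j)) ⟩
    suc j * (suc (suc j) * centralBinomial (suc j)) ∎)
    where
    open ≤-Reasoning
    c = centralBinomial j
    regroup : ∀ j c → 4 * (suc j * (suc j * c)) ≡ (4 * suc j * suc j) * c
    regroup = solve-∀
    expand : ∀ j → suc (suc j) * (2 * suc (j + j)) ≡ 4 * suc j * suc j + (j + j)
    expand = solve-∀
    4[j+1]²≤[j+2]*2[2j+1] : 4 * suc j * suc j ≤ suc (suc j) * (2 * suc (j + j))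
    4[j+1]²≤[j+2]*2[2j+1] = subst (4 * suc j * suc j ≤_) (sym (expand j)) (m≤m+n _ _)

  2^[j+j]≡4^j : ∀ j → 2 ^ (j + j) ≡ 4 ^ j
  2^[j+j]≡4^j j = trans (cong (2 ^_) (j+j≡2*j j)) (sym (^-*-assoc 2 2 j))
    where
    j+j≡2*j : ∀ j → j + j ≡ 2 * j
    j+j≡2*j = solve-∀

  2^[2j+2]≤2*centralBinomial*[2j+2] : ∀ j → let n = suc (suc (j + j)) in 2 ^ n ≤ 2 * centralBinomial j * n
  2^[2j+2]≤2*centralBinomial*[2j+2] j = begin
    2 * (2 * 2 ^ (j + j))   ≡⟨ 2*[2*m]≡4*m (2 ^ (j + j)) ⟩
    4 * 2 ^ (j + j)         ≡⟨ cong (4 *_) (2^[j+j]≡4^j j) ⟩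
    4 * 4 ^ j               ≤⟨ *-monoʳ-≤ 4 (4^j≤[j+1]*centralBinomial j) ⟩
    4 * (suc j * c)         ≡⟨ regroup j c ⟩
    2 * c * suc (suc (j + j)) ∎
    where
    open ≤-Reasoning
    c = centralBinomial j
    2*[2*m]≡4*m : ∀ m → 2 * (2 * m) ≡ 4 * m
    2*[2*m]≡4*m = solve-∀
    regroup : ∀ j c → 4 * (suc j * c) ≡ 2 * c * suc (suc (j + j))
    regroup = solve-∀

-- Alternating binomial sums and signed sums over strings
module _ where
  open import Data.Nat using (_⊓_; _∸_; z≤n; s≤s)
  open import Data.Integer using (_+_; _-_; _*_; _^_; 0ℤ)
  open import Data.Integer.Tactic.RingSolver using (solve-∀)
  open import Relation.Nullary using (yes; no)

  -- alt L F = Σ_{k ≤ L} (-1)^k (L C k) F k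
  alt : ℕ → (ℕ → ℤ) → ℤ
  alt zero    F = F 0
  alt (suc L) F = alt L F - alt L (F ∘ suc)

  alt-cong : ∀ L {F G} → (∀ k → k ℕ.≤ L → F k ≡ G k) → alt L F ≡ alt L G
  alt-cong zero    F≗G = F≗G 0 z≤n
  alt-cong (suc L) F≗G = cong₂ _-_
    (alt-cong L (λ k k≤L → F≗G k (ℕ.m≤n⇒m≤1+n k≤L)))
    (alt-cong L (λ k k≤L → F≗G (suc k) (s≤s k≤L)))

  alt-linear : ∀ L F G → alt L F - alt L G ≡ alt L (λ k → F k - G k)
  alt-linear zero    F G = refl
  alt-linear (suc L) F G = trans (interchange (alt L F) (alt L (F ∘ suc)) (alt L G) (alt L (G ∘ suc)))
    (cong₂ _-_ (alt-linear L F G) (alt-linear L (F ∘ suc) (G ∘ suc)))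
    where
    interchange : ∀ a b c d → (a - b) - (c - d) ≡ (a - c) - (b - d)
    interchange = solve-∀

  alt-const : ∀ L x → alt (suc L) (λ _ → x) ≡ 0ℤ
  alt-const L x = ℤ.+-inverseʳ (alt L (λ _ → x))

  alt-0 : ∀ L → alt L (λ _ → 0ℤ) ≡ 0ℤ
  alt-0 zero    = refl
  alt-0 (suc L) = alt-const L 0ℤ

  δ : ℕ → ℕ → ℤ
  δ zero    zero    = 1ℤ
  δ zero    (suc k) = 0ℤ
  δ (suc j) zero    = 0ℤ
  δ (suc j) (suc k) = δ j k

  alt-δ : ∀ L j → alt L (δ j) ≡ -1ℤ ^ j * + (L C j)
  alt-δ zero    zero    = refl
  alt-δ zero    (suc j) = sym (ℤ.*-zeroʳ (-1ℤ ^ suc j))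
  alt-δ (suc L) zero    = cong₂ _-_ (alt-δ L zero) (alt-0 L)
  alt-δ (suc L) (suc j) = begin
    alt L (δ (suc j)) - alt L (δ j)                   ≡⟨ cong₂ _-_ (alt-δ L (suc j)) (alt-δ L j) ⟩
    -1ℤ * s * + (L C suc j) - s * + (L C j)           ≡⟨ collect s (+ (L C j)) (+ (L C suc j)) ⟩
    -1ℤ * s * (+ (L C j) + + (L C suc j))             ≡⟨ cong (-1ℤ * s *_) (ℤ.pos-+ (L C j) (L C suc j)) ⟨
    -1ℤ * s * + (L C j ℕ.+ L C suc j)                 ≡⟨ cong (λ m → -1ℤ * s * + m) (nCk+nC[k+1]≡[n+1]C[k+1] L j) ⟩
    -1ℤ * s * + (suc L C suc j)                       ∎
    where
    open ≡-Reasoning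
    s = -1ℤ ^ j
    collect : ∀ s x y → -1ℤ * s * y - s * x ≡ -1ℤ * s * (x + y)
    collect = solve-∀

  atMost : ℕ → ℕ → ℤ
  atMost j       zero    = 1ℤ
  atMost zero    (suc k) = 0ℤ
  atMost (suc j) (suc k) = atMost j k

  atMost-Δ : ∀ j k → atMost j k - atMost j (suc k) ≡ δ j k
  atMost-Δ zero    zero    = refl
  atMost-Δ zero    (suc k) = refl
  atMost-Δ (suc j) zero    = refl
  atMost-Δ (suc j) (suc k) = atMost-Δ j k

  atMost-≤ : ∀ {j k} → k ℕ.≤ j → atMost j k ≡ 1ℤ
  atMost-≤ {j}     {zero}  _         = refl
  atMost-≤ {suc j} {suc k} (s≤s k≤j) = atMost-≤ k≤j

  atMost-> : ∀ {j k} → j ℕ.< k → atMost j k ≡ 0ℤ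
  atMost-> {zero}  {suc k} _         = refl
  atMost-> {suc j} {suc k} (s≤s j<k) = atMost-> j<k

  alt-atMost : ∀ L j → alt (suc L) (atMost j) ≡ -1ℤ ^ j * + (L C j)
  alt-atMost L j = trans (alt-linear L (atMost j) (atMost j ∘ suc))
    (trans (alt-cong L (λ k _ → atMost-Δ j k)) (alt-δ L j))

  distProfile : ℕ → ℕ → ℕ
  distProfile n k = k ⊓ (n ∸ k)

  distProfile-≤ : ∀ {n} k → k ℕ.+ k ℕ.≤ n → distProfile n k ≡ k
  distProfile-≤ k k+k≤n = ℕ.m≤n⇒m⊓n≡m (ℕ.m+n≤o⇒m≤o∸n k k+k≤n)

  distProfile-≥ : ∀ {n} k → n ℕ.≤ k ℕ.+ k → distProfile n k ≡ n ∸ k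
  distProfile-≥ {n} k n≤k+k = ℕ.m≥n⇒m⊓n≡n (ℕ.m≤n+o⇒m∸n≤o n k n≤k+k)

  distProfile-rising : ∀ {j k} → k ℕ.≤ j → let n = suc (suc (j ℕ.+ j)) in
    + distProfile n k - + distProfile n (suc k) ≡ -1ℤ
  distProfile-rising {j} {k} k≤j = begin
    + distProfile n k - + distProfile n (suc k) ≡⟨ cong₂ (λ x y → + x - + y) (distProfile-≤ k 2k≤n) (distProfile-≤ (suc k) 2k+2≤n) ⟩
    + k - + suc k                               ≡⟨ cong (λ x → + k - x) (ℤ.pos-+ 1 k) ⟩
    + k - (1ℤ + + k)                            ≡⟨ x-[1+x]≡-1 (+ k) ⟩
    -1ℤ                                         ∎
    where
    open ≡-Reasoning
    n = suc (suc (j ℕ.+ j))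
    2k+2≤n : suc k ℕ.+ suc k ℕ.≤ n
    2k+2≤n = ℕ.≤-trans (ℕ.+-mono-≤ (s≤s k≤j) (s≤s k≤j)) (ℕ.≤-reflexive (cong suc (ℕ.+-suc j j)))
    2k≤n : k ℕ.+ k ℕ.≤ n
    2k≤n = ℕ.≤-trans (ℕ.+-mono-≤ (ℕ.n≤1+n k) (ℕ.n≤1+n k)) 2k+2≤n
    x-[1+x]≡-1 : ∀ x → x - (1ℤ + x) ≡ -1ℤ
    x-[1+x]≡-1 = solve-∀

  distProfile-falling : ∀ {j k} → j ℕ.< k → k ℕ.≤ suc (j ℕ.+ j) → let n = suc (suc (j ℕ.+ j)) in
    + distProfile n k - + distProfile n (suc k) ≡ 1ℤ
  distProfile-falling {j} {k} j<k k<n = begin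
    + distProfile n k - + distProfile n (suc k) ≡⟨ cong₂ (λ x y → + x - + y) (distProfile-≥ k n≤2k) (distProfile-≥ (suc k) n≤2k+2) ⟩
    + (n ∸ k) - + (n ∸ suc k)                   ≡⟨ cong (λ x → + x - + (n ∸ suc k)) (ℕ.+-∸-assoc 1 k<n) ⟩
    + suc (n ∸ suc k) - + (n ∸ suc k)           ≡⟨ cong (_- + (n ∸ suc k)) (ℤ.pos-+ 1 (n ∸ suc k)) ⟩
    (1ℤ + + (n ∸ suc k)) - + (n ∸ suc k)        ≡⟨ [1+x]-x≡1 (+ (n ∸ suc k)) ⟩
    1ℤ                                          ∎
    where
    open ≡-Reasoning
    n = suc (suc (j ℕ.+ j))
    n≤2k : n ℕ.≤ k ℕ.+ k
    n≤2k = ℕ.≤-trans (ℕ.≤-reflexive (cong suc (sym (ℕ.+-suc j j)))) (ℕ.+-mono-≤ j<k j<k)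
    n≤2k+2 : n ℕ.≤ suc k ℕ.+ suc k
    n≤2k+2 = ℕ.≤-trans n≤2k (ℕ.+-mono-≤ (ℕ.n≤1+n k) (ℕ.n≤1+n k))
    [1+x]-x≡1 : ∀ x → (1ℤ + x) - x ≡ 1ℤ
    [1+x]-x≡1 = solve-∀

  distProfile-Δ : ∀ j k → k ℕ.≤ suc (j ℕ.+ j) → let n = suc (suc (j ℕ.+ j)) in
    + distProfile n k - + distProfile n (suc k) ≡ (1ℤ - atMost j k) - atMost j k
  distProfile-Δ j k k<n with k ℕ.≤? j
  ... | yes k≤j = trans (distProfile-rising k≤j) (cong (λ a → (1ℤ - a) - a) (sym (atMost-≤ k≤j)))
  ... | no  k≰j = trans (distProfile-falling j<k k<n) (cong (λ a → (1ℤ - a) - a) (sym (atMost-> j<k)))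
    where j<k = ℕ.≰⇒> k≰j

  alt-distProfile : ∀ j → let n = suc (suc (j ℕ.+ j)) in
    alt n (λ k → + distProfile n k) ≡ -1ℤ ^ suc j * + (2 ℕ.* centralBinomial j)
  alt-distProfile j = begin
    alt (suc L) d                                    ≡⟨ alt-linear L d (d ∘ suc) ⟩
    alt L (λ k → d k - d (suc k))                    ≡⟨ alt-cong L (distProfile-Δ j) ⟩
    alt L (λ k → (1ℤ - atMost j k) - atMost j k)     ≡⟨ alt-linear L (λ k → 1ℤ - atMost j k) (atMost j) ⟨
    alt L (λ k → 1ℤ - atMost j k) - alt L (atMost j) ≡⟨ cong (_- alt L (atMost j)) (alt-linear L (λ _ → 1ℤ) (atMost j)) ⟨
    (alt L (λ _ → 1ℤ) - alt L (atMost j)) - alt L (atMost j)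
      ≡⟨ cong₂ (λ x y → (x - y) - y) (alt-const (j ℕ.+ j) 1ℤ) (alt-atMost (j ℕ.+ j) j) ⟩
    (0ℤ - s * + c) - s * + c                         ≡⟨ collect s (+ c) ⟩
    -1ℤ * s * (+ 2 * + c)                            ≡⟨ cong (-1ℤ * s *_) (ℤ.pos-* 2 c) ⟨
    -1ℤ * s * + (2 ℕ.* c)                            ∎
    where
    open ≡-Reasoning
    L = suc (j ℕ.+ j)
    d : ℕ → ℤ
    d k = + distProfile (suc L) k
    s = -1ℤ ^ j
    c = centralBinomial j
    collect : ∀ s c → (0ℤ - s * c) - s * c ≡ -1ℤ * s * (+ 2 * c)
    collect = solve-∀

  sign : Bool → ℤ
  sign false = 1ℤ
  sign true  = -1ℤ

  sign-xor : ∀ a b → sign (a xor b) ≡ sign a * sign b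
  sign-xor false b     = sym (ℤ.*-identityˡ (sign b))
  sign-xor true  false = refl
  sign-xor true  true  = refl

  signedSum : ∀ {n} → (BitString n → ℤ) → List (BitString n) → ℤ
  signedSum f []       = 0ℤ
  signedSum f (x ∷ xs) = sign (parity x) * f x + signedSum f xs

  signedSum-++ : ∀ {n} (f : BitString n → ℤ) xs ys → signedSum f (xs ++ ys) ≡ signedSum f xs + signedSum f ys
  signedSum-++ f []       ys = sym (ℤ.+-identityˡ (signedSum f ys))
  signedSum-++ f (x ∷ xs) ys = trans (cong (λ t → sign (parity x) * f x + t) (signedSum-++ f xs ys))
    (sym (ℤ.+-assoc (sign (parity x) * f x) (signedSum f xs) (signedSum f ys)))

  signedSum-map-∷ : ∀ {n} (f : BitString (suc n) → ℤ) b xs →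
    signedSum f (map (b ∷_) xs) ≡ sign b * signedSum (f ∘ (b ∷_)) xs
  signedSum-map-∷ f b []       = sym (ℤ.*-zeroʳ (sign b))
  signedSum-map-∷ f b (x ∷ xs) = begin
    sign (b xor parity x) * f (b ∷ x) + signedSum f (map (b ∷_) xs)
      ≡⟨ cong₂ (λ s t → s * f (b ∷ x) + t) (sign-xor b (parity x)) (signedSum-map-∷ f b xs) ⟩
    sign b * sign (parity x) * f (b ∷ x) + sign b * signedSum (f ∘ (b ∷_)) xs
      ≡⟨ factor (sign b) (sign (parity x)) (f (b ∷ x)) (signedSum (f ∘ (b ∷_)) xs) ⟩
    sign b * (sign (parity x) * f (b ∷ x) + signedSum (f ∘ (b ∷_)) xs) ∎
    where
    open ≡-Reasoning
    factor : ∀ s t y z → s * t * y + s * z ≡ s * (t * y + z)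
    factor = solve-∀

  signedSum-allStrings : ∀ L F → signedSum (F ∘ ones) (allStrings L) ≡ alt L F
  signedSum-allStrings zero    F = trans (ℤ.+-identityʳ _) (ℤ.*-identityˡ (F 0))
  signedSum-allStrings (suc L) F = begin
    signedSum (F ∘ ones) (map (false ∷_) xs ++ map (true ∷_) xs)
      ≡⟨ signedSum-++ (F ∘ ones) (map (false ∷_) xs) (map (true ∷_) xs) ⟩
    signedSum (F ∘ ones) (map (false ∷_) xs) + signedSum (F ∘ ones) (map (true ∷_) xs)
      ≡⟨ cong₂ _+_ (signedSum-map-∷ (F ∘ ones) false xs) (signedSum-map-∷ (F ∘ ones) true xs) ⟩
    1ℤ * signedSum (F ∘ ones) xs + -1ℤ * signedSum (F ∘ suc ∘ ones) xs
      ≡⟨ cong₂ (λ u v → 1ℤ * u + -1ℤ * v) (signedSum-allStrings L F) (signedSum-allStrings L (F ∘ suc)) ⟩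
    1ℤ * alt L F + -1ℤ * alt L (F ∘ suc)
      ≡⟨ cong₂ _+_ (ℤ.*-identityˡ (alt L F)) (ℤ.-1*i≡-i (alt L (F ∘ suc))) ⟩
    alt L F - alt L (F ∘ suc) ∎
    where
    open ≡-Reasoning
    xs = allStrings L

  signedSum-cong : ∀ {n} {f g : BitString n → ℤ} → (∀ x → f x ≡ g x) → ∀ xs → signedSum f xs ≡ signedSum g xs
  signedSum-cong f≗g []       = refl
  signedSum-cong f≗g (x ∷ xs) = cong₂ (λ y t → sign (parity x) * y + t) (f≗g x) (signedSum-cong f≗g xs)

  signedSum+2*oddSum≡sum : ∀ {n} (g : BitString n → ℕ) xs →
    signedSum (+_ ∘ g) xs + + (2 ℕ.* sum (map g (filter (λ x → parity x ≟ᵇ true) xs))) ≡ + sum (map g xs)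
  signedSum+2*oddSum≡sum g []       = refl
  signedSum+2*oddSum≡sum g (x ∷ xs) with parity x | signedSum+2*oddSum≡sum g xs
  ... | false | ih = begin
    (1ℤ * y + S) + + (2 ℕ.* T) ≡⟨ regroup y S (+ (2 ℕ.* T)) ⟩
    y + (S + + (2 ℕ.* T))      ≡⟨ cong (λ t → y + t) ih ⟩
    y + + sum (map g xs)       ≡⟨ ℤ.pos-+ (g x) (sum (map g xs)) ⟨
    + sum (map g (x ∷ xs))     ∎
    where
    open ≡-Reasoning
    y = + g x
    S = signedSum (+_ ∘ g) xs
    T = sum (map g (filter (λ x → parity x ≟ᵇ true) xs))
    regroup : ∀ y s t → (1ℤ * y + s) + t ≡ y + (s + t)
    regroup = solve-∀
  ... | true | ih = begin
    (-1ℤ * y + S) + + (2 ℕ.* (g x ℕ.+ T)) ≡⟨ cong (λ t → (-1ℤ * y + S) + t) (trans (ℤ.pos-* 2 (g x ℕ.+ T)) (cong (λ t → + 2 * t) (ℤ.pos-+ (g x) T))) ⟩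
    (-1ℤ * y + S) + + 2 * (y + + T)       ≡⟨ regroup y S (+ T) ⟩
    y + (S + + 2 * + T)                   ≡⟨ cong (λ t → y + (S + t)) (ℤ.pos-* 2 T) ⟨
    y + (S + + (2 ℕ.* T))                 ≡⟨ cong (λ t → y + t) ih ⟩
    y + + sum (map g xs)                  ≡⟨ ℤ.pos-+ (g x) (sum (map g xs)) ⟨
    + sum (map g (x ∷ xs))                ∎
    where
    open ≡-Reasoning
    y = + g x
    S = signedSum (+_ ∘ g) xs
    T = sum (map g (filter (λ x → parity x ≟ᵇ true) xs))
    regroup : ∀ y s t → (-1ℤ * y + s) + + 2 * (y + t) ≡ y + (s + + 2 * t)
    regroup = solve-∀

  sum-map-const-1 : ∀ {A : Set} (xs : List A) → sum (map (λ _ → 1) xs) ≡ length xs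
  sum-map-const-1 []       = refl
  sum-map-const-1 (x ∷ xs) = cong suc (sum-map-const-1 xs)

  length-allStrings : ∀ n → length (allStrings n) ≡ 2 ℕ.^ n
  length-allStrings zero    = refl
  length-allStrings (suc n) = begin
    length (map (false ∷_) xs ++ map (true ∷_) xs)           ≡⟨ List.length-++ (map (false ∷_) xs) ⟩
    length (map (false ∷_) xs) ℕ.+ length (map (true ∷_) xs) ≡⟨ cong₂ ℕ._+_ (List.length-map (false ∷_) xs) (List.length-map (true ∷_) xs) ⟩
    length xs ℕ.+ length xs                                   ≡⟨ cong (λ m → m ℕ.+ m) (length-allStrings n) ⟩
    2 ℕ.^ n ℕ.+ 2 ℕ.^ n                                       ≡⟨ cong (2 ℕ.^ n ℕ.+_) (ℕ.+-identityʳ (2 ℕ.^ n)) ⟨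
    2 ℕ.^ suc n                                               ∎
    where
    open ≡-Reasoning
    xs = allStrings n

  length-oddStrings : ∀ n → length (oddStrings (suc n)) ≡ 2 ℕ.^ n
  length-oddStrings n = ℕ.*-cancelˡ-≡ _ _ 2 (ℤ.+-injective (begin
    + (2 ℕ.* length odd)                                       ≡⟨ cong (λ m → + (2 ℕ.* m)) (sum-map-const-1 odd) ⟨
    + (2 ℕ.* sum (map (λ _ → 1) odd))                          ≡⟨ ℤ.+-identityˡ _ ⟨
    0ℤ + + (2 ℕ.* sum (map (λ _ → 1) odd))                     ≡⟨ cong (λ t → t + + (2 ℕ.* sum (map (λ _ → 1) odd))) vanishes ⟨
    signedSum (λ _ → 1ℤ) all + + (2 ℕ.* sum (map (λ _ → 1) odd)) ≡⟨ signedSum+2*oddSum≡sum (λ _ → 1) all ⟩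
    + sum (map (λ _ → 1) all)                                  ≡⟨ cong +_ (trans (sum-map-const-1 all) (length-allStrings (suc n))) ⟩
    + (2 ℕ.^ suc n)                                            ∎))
    where
    open ≡-Reasoning
    all = allStrings (suc n)
    odd = oddStrings (suc n)
    vanishes : signedSum (λ _ → 1ℤ) all ≡ 0ℤ
    vanishes = trans (signedSum-allStrings (suc n) (λ _ → 1ℤ)) (alt-const n 1ℤ)

  ones+zeros : ∀ {n} (x : BitString n) → ones x ℕ.+ zeros x ≡ n
  ones+zeros []          = refl
  ones+zeros (true ∷ x)  = cong suc (ones+zeros x)
  ones+zeros (false ∷ x) = trans (ℕ.+-suc (ones x) (zeros x)) (cong suc (ones+zeros x))

  distConst≡distProfile : ∀ {n} (x : BitString n) → distConst x ≡ distProfile n (ones x)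
  distConst≡distProfile {n} x = cong (ones x ⊓_) (trans (sym (ℕ.m+n∸m≡n (ones x) (zeros x))) (cong (_∸ ones x) (ones+zeros x)))

  signedSum-distConst : ∀ j → let n = suc (suc (j ℕ.+ j)) in
    signedSum (+_ ∘ distConst) (allStrings n) ≡ -1ℤ ^ suc j * + (2 ℕ.* centralBinomial j)
  signedSum-distConst j = begin
    signedSum (+_ ∘ distConst) (allStrings n)                   ≡⟨ signedSum-cong (cong +_ ∘ distConst≡distProfile) (allStrings n) ⟩
    signedSum ((λ k → + distProfile n k) ∘ ones) (allStrings n) ≡⟨ signedSum-allStrings n (λ k → + distProfile n k) ⟩
    alt n (λ k → + distProfile n k)                             ≡⟨ alt-distProfile j ⟩
    -1ℤ ^ suc j * + (2 ℕ.* centralBinomial j)               ∎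
    where
    open ≡-Reasoning
    n = suc (suc (j ℕ.+ j))

-- From the signed sum to expectations
open import Data.Nat.Divisibility using (_∣_; divides)
open import Data.Nat.Tactic.RingSolver using (solve-∀)
open import Data.Rational as ℚ using (_≤_; _-_; _/_; toℚᵘ)
import Data.Rational.Properties as ℚ
open import Data.Rational.Unnormalised as ℚᵘ using (_≃_; *≤*)
import Data.Rational.Unnormalised.Properties as ℚᵘ
open import Data.Empty using (⊥-elim-irr)

toℚᵘ-/ : ∀ i d → toℚᵘ (i / suc d) ≃ i ℚᵘ./ suc d
toℚᵘ-/ i d = ℚ.toℚᵘ-fromℚᵘ (i ℚᵘ./ suc d)

-- The unfolded form of a / Q ≤ b / P − 1 / N in ℚᵘ, with P = 2Q and b = 2a + c.
cross-multiplied-≤ : ∀ a c Q N → let P = 2 ℕ.* Q ; b = 2 ℕ.* a ℕ.+ c in P ℕ.≤ c ℕ.* N →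
  + a ℤ.* + (P ℕ.* N) ℤ.≤ (+ b ℤ.* + N ℤ.+ -1ℤ ℤ.* + P) ℤ.* + Q
cross-multiplied-≤ a c Q N P≤cN = subst₂ ℤ._≤_ (ℤ.pos-* a (P ℕ.* N)) bN-P (ℤ.+≤+ (begin
  a ℕ.* (P ℕ.* N)                   ≡⟨ regroup a Q N ⟩
  2 ℕ.* a ℕ.* N ℕ.* Q                ≤⟨ ℕ.*-monoˡ-≤ Q (ℕ.m≤m+n (2 ℕ.* a ℕ.* N) (c ℕ.* N ℕ.∸ P)) ⟩
  (2 ℕ.* a ℕ.* N ℕ.+ (c ℕ.* N ℕ.∸ P)) ℕ.* Q ≡⟨ cong (ℕ._* Q) (ℕ.+-∸-assoc (2 ℕ.* a ℕ.* N) P≤cN) ⟨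
  (2 ℕ.* a ℕ.* N ℕ.+ c ℕ.* N ℕ.∸ P) ℕ.* Q  ≡⟨ cong (λ m → (m ℕ.∸ P) ℕ.* Q) (ℕ.*-distribʳ-+ N (2 ℕ.* a) c) ⟨
  (b ℕ.* N ℕ.∸ P) ℕ.* Q                ∎))
  where
  open ℕ.≤-Reasoning
  P = 2 ℕ.* Q
  b = 2 ℕ.* a ℕ.+ c
  regroup : ∀ a q n → a ℕ.* (2 ℕ.* q ℕ.* n) ≡ 2 ℕ.* a ℕ.* n ℕ.* q
  regroup = solve-∀
  P≤bN : P ℕ.≤ b ℕ.* N
  P≤bN = ℕ.≤-trans P≤cN (ℕ.≤-trans (ℕ.m≤n+m (c ℕ.* N) (2 ℕ.* a ℕ.* N))
           (ℕ.≤-reflexive (sym (ℕ.*-distribʳ-+ N (2 ℕ.* a) c))))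
  bN-P : + ((b ℕ.* N ℕ.∸ P) ℕ.* Q) ≡ (+ b ℤ.* + N ℤ.+ -1ℤ ℤ.* + P) ℤ.* + Q
  bN-P = ≡.begin
    + ((b ℕ.* N ℕ.∸ P) ℕ.* Q)          ≡.≡⟨ ℤ.pos-* (b ℕ.* N ℕ.∸ P) Q ⟩
    + (b ℕ.* N ℕ.∸ P) ℤ.* + Q          ≡.≡⟨ cong (ℤ._* + Q) (ℤ.⊖-≥ P≤bN) ⟨
    (b ℕ.* N ℤ.⊖ P) ℤ.* + Q            ≡.≡⟨ cong (ℤ._* + Q) (ℤ.m-n≡m⊖n (b ℕ.* N) P) ⟨
    (+ (b ℕ.* N) ℤ.- + P) ℤ.* + Q    ≡.≡⟨ cong₂ (λ x y → (x ℤ.+ y) ℤ.* + Q) (ℤ.pos-* b N) (sym (ℤ.-1*i≡-i (+ P))) ⟩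
    (+ b ℤ.* + N ℤ.+ -1ℤ ℤ.* + P) ℤ.* + Q ≡.∎
    where module ≡ = ≡-Reasoning

a/q≤[2a+c]/2q-1/n : ∀ a c q n → 2 ℕ.* suc q ℕ.≤ c ℕ.* suc n →
  + a / suc q ℚ.≤ + (2 ℕ.* a ℕ.+ c) / (2 ℕ.* suc q) ℚ.- + 1 / suc n
a/q≤[2a+c]/2q-1/n a c q n P≤cN = ℚ.toℚᵘ-cancel-≤ (begin
  toℚᵘ (+ a / Q)                             ≃⟨ toℚᵘ-/ (+ a) q ⟩
  + a ℚᵘ./ Q                                 ≤⟨ *≤* (cross-multiplied-≤ a c Q N P≤cN) ⟩
  + b ℚᵘ./ P ℚᵘ.- + 1 ℚᵘ./ N                 ≃⟨ ℚᵘ.+-cong (toℚᵘ-/ (+ b) _) (ℚᵘ.-‿cong (toℚᵘ-/ (+ 1) n)) ⟨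
  toℚᵘ (+ b / P) ℚᵘ.- toℚᵘ (+ 1 / N)         ≃⟨ ℚᵘ.+-congʳ (toℚᵘ (+ b / P)) (ℚ.toℚᵘ-homo‿- (+ 1 / N)) ⟨
  toℚᵘ (+ b / P) ℚᵘ.+ toℚᵘ (ℚ.- (+ 1 / N))   ≃⟨ ℚ.toℚᵘ-homo-+ (+ b / P) (ℚ.- (+ 1 / N)) ⟨
  toℚᵘ (+ b / P ℚ.- + 1 / N)                 ∎)
  where
  open ℚᵘ.≤-Reasoning
  Q = suc q
  P = 2 ℕ.* Q
  N = suc n
  b = 2 ℕ.* a ℕ.+ c

expect-≡ : ∀ {A : Set} (f : A → ℕ) xs {m} → length xs ≡ suc m → expect f xs ≡ + sum (map f xs) / suc m
expect-≡ f (x ∷ xs) refl = refl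

expect-gap : ∀ j n .{{_ : NonZero n}} → n ≡ suc (suc (j ℕ.+ j)) → -1ℤ ℤ.^ suc j ≡ 1ℤ →
  expect distConst (oddStrings n) ≤ expect distConst (allStrings n) - + 1 / n
expect-gap j .(suc (suc (j ℕ.+ j))) refl even = begin
  expect distConst odd                      ≡⟨ expect-≡ distConst odd |odd| ⟩
  + a / Q                                   ≤⟨ a/q≤[2a+c]/2q-1/n a σ q N 2Q≤σn ⟩
  + (2 ℕ.* a ℕ.+ σ) / (2 ℕ.* Q) - + 1 / n   ≡⟨ cong (λ b → + b / (2 ℕ.* Q) - + 1 / n) b≡2a+σ ⟨
  + b / (2 ℕ.* Q) - + 1 / n                 ≡⟨ cong (_- + 1 / n) (expect-≡ distConst all |all|) ⟨
  expect distConst all - + 1 / n            ∎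
  where
  open ℚ.≤-Reasoning
  N = suc (j ℕ.+ j)
  n = suc N
  all = allStrings n
  odd = oddStrings n
  a = sum (map distConst odd)
  b = sum (map distConst all)
  c = centralBinomial j
  σ = 2 ℕ.* c
  instance _ = ℕ.m^n≢0 2 N
  -- 2^N in the form suc q required by the division lemmas
  q = ℕ.pred (2 ℕ.^ N)
  Q = suc q
  Q≡2^N : Q ≡ 2 ℕ.^ N
  Q≡2^N = ℕ.suc-pred (2 ℕ.^ N)
  |odd| : length odd ≡ Q
  |odd| = trans (length-oddStrings N) (sym Q≡2^N)
  |all| : length all ≡ 2 ℕ.* Q
  |all| = trans (length-allStrings n) (cong (2 ℕ.*_) (sym Q≡2^N))
  signedSum≡σ : signedSum (+_ ∘ distConst) all ≡ + σ
  signedSum≡σ = trans (signedSum-distConst j) (trans (cong (ℤ._* + σ) even) (ℤ.*-identityˡ (+ σ)))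
  b≡2a+σ : b ≡ 2 ℕ.* a ℕ.+ σ
  b≡2a+σ = trans (ℤ.+-injective (trans (sym (signedSum+2*oddSum≡sum distConst all))
                   (trans (cong (ℤ._+ + (2 ℕ.* a)) signedSum≡σ) (sym (ℤ.pos-+ σ (2 ℕ.* a))))))
                 (ℕ.+-comm σ (2 ℕ.* a))
  2Q≤σn : 2 ℕ.* Q ℕ.≤ σ ℕ.* n
  2Q≤σn = subst (ℕ._≤ σ ℕ.* n) (trans (sym (length-allStrings n)) |all|) (2^[2j+2]≤2*centralBinomial*[2j+2] j)

-1^[i+i]≡1 : ∀ i → -1ℤ ℤ.^ (i ℕ.+ i) ≡ 1ℤ
-1^[i+i]≡1 i = trans (cong (-1ℤ ℤ.^_) (i+i≡2*i i)) (trans (sym (ℤ.^-*-assoc -1ℤ 2 i)) (ℤ.^-zeroˡ i))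
  where
  i+i≡2*i : ∀ i → i ℕ.+ i ≡ 2 ℕ.* i
  i+i≡2*i = solve-∀

lemma4 : (n : ℕ) → .{{_ : NonZero n}} → 4 ∣ n →
    expect distConst (oddStrings n) ≤ expect distConst (allStrings n) - (+ 1) / n
lemma4 n {{n≢0}} (divides zero refl)  = ⊥-elim-irr (NonZero.nonZero n≢0)
lemma4 n (divides (suc i) n≡[1+i]*4) =
  expect-gap j n (trans n≡[1+i]*4 (4[1+i]≡2+2j i)) (trans (cong (-1ℤ ℤ.^_) (1+j≡[1+i]+[1+i] i)) (-1^[i+i]≡1 (suc i)))
  where
  j = suc (i ℕ.+ i)
  4[1+i]≡2+2j : ∀ i → suc i ℕ.* 4 ≡ suc (suc (suc (i ℕ.+ i) ℕ.+ suc (i ℕ.+ i)))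
  4[1+i]≡2+2j = solve-∀
  1+j≡[1+i]+[1+i] : ∀ i → suc (suc (i ℕ.+ i)) ≡ suc i ℕ.+ suc i
  1+j≡[1+i]+[1+i] = solve-∀
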